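{- Let $X_1,\dots,X_n$ be binary random variables with joint distribution $p$, and suppose a probabilistic generating circuit (PGC) of size $s$ computes the probability generating polynomial $f(z_1,\dots,z_n)=\sum_{S\subseteq[n]} p(S)\prod_{i\in S} z_i$, where $p(S)=\Pr[X_i=1 \text{ for } i\in S,\ X_i=0 \text{ for } i\notin S]$. Then there is a nonmonotone probabilistic circuit of size $\mathrm{poly}(s,n)$ with inputs $x_1,\bar x_1,\dots,x_n,\bar x_n$ computing the polynomial $g(x_1,\bar x_1,\dots,x_n,\bar x_n)=\sum_{S\subseteq[n]} p(S)\prod_{i\in S}x_i\prod_{i\notin S}\bar x_i$, i.e., the probability mass function of the distribution; $g$ is set-multilinear with respect to the partition $\{x_i,\bar x_i\}$, $1\le i\le n$. That is, PGCs over binary variables can be simulated by nonmonotone PCs with only polynomial overhead in size.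
   Context: An arithmetic circuit is a directed acyclic graph whose input nodes are labeled by variables or constants, and whose internal nodes are addition nodes (computing a weighted sum of their inputs with edge weights) or multiplication nodes (computing the product of their inputs). A probabilistic generating circuit (PGC) is an arithmetic circuit (with possibly negative constants) computing the probability generating polynomial of a distribution. A probabilistic circuit (PC) over binary variables is an arithmetic circuit whose inputs are the indicators $x_i,\bar x_i$ and which computes the probability mass function: setting $x_i=a_i$, $\bar x_i=1-a_i$ for $a\in\{0,1\}^n$ yields $\Pr[X=a]$. A PC is nonmonotone if its edge weights may be negative. A polynomial is set-multilinear with respect to a partition $Y_1,\dots,Y_t$ of its variables if each monomial contains exactly one variable from each $Y_\tau$, with degree $1$.
   Formalization: The probabilities p(S) of the distribution, and the constants and edge weights of the PGC, are rational. -}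

module Defs where

open import Data.Nat as ℕ using (ℕ; zero; suc)
open import Data.Fin using (Fin; zero; suc)
open import Data.Bool using (Bool; true; false; if_then_else_)
open import Data.List using (List; []; _∷_; length)
open import Data.Product using (_×_; _,_)
open import Data.Vec using (Vec; []; _∷_; lookup; _∷ʳ_)
open import Data.Rational using (ℚ; 0ℚ; 1ℚ; _+_; _*_)

-- Arithmetic circuits as straight-line programs (DAGs in topological
-- order).  Variables range over
-- an arbitrary type V; constants and edge weights are arbitrary
-- rationals (possibly negative).

data Gate (V : Set) (k : ℕ) : Set where
  var   : V → Gate V k
  const : ℚ → Gate V k
  add   : List (ℚ × Fin k) → Gate V k
  mul   : List (Fin k) → Gate V k

data Circuit (V : Set) : ℕ → Set where
  []  : Circuit V zero
  _▷_ : ∀ {k} → Circuit V k → Gate V k → Circuit V (suc k)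

fanin : ∀ {V k} → Gate V k → ℕ
fanin (var _)   = 0
fanin (const _) = 0
fanin (add xs)  = length xs
fanin (mul xs)  = length xs

size : ∀ {V k} → Circuit V k → ℕ
size []      = 0
size (C ▷ g) = suc (fanin g ℕ.+ size C)

evalGate : ∀ {V k} → Gate V k → Vec ℚ k → (V → ℚ) → ℚ
evalGate (var v)   vs a = a v
evalGate (const q) vs a = q
evalGate (add xs)  vs a = go xs
  where
  go : List (ℚ × Fin _) → ℚ
  go []             = 0ℚ
  go ((w , j) ∷ ys) = w * lookup vs j + go ys
evalGate (mul xs)  vs a = go xs
  where
  go : List (Fin _) → ℚ
  go []       = 1ℚ
  go (j ∷ ys) = lookup vs j * go ys

evalAll : ∀ {V k} → Circuit V k → (V → ℚ) → Vec ℚ k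
evalAll []      a = []
evalAll (C ▷ g) a = evalAll C a ∷ʳ evalGate g (evalAll C a) a

output : ∀ {V k} → Circuit V (suc k) → (V → ℚ) → ℚ
output (C ▷ g) a = evalGate g (evalAll C a) a

-- Subsets of [n] as characteristic vectors (Data.Fin.Subset convention).

sumSubsets : (n : ℕ) → (Vec Bool n → ℚ) → ℚ
sumSubsets zero    f = f []
sumSubsets (suc n) f = sumSubsets n (λ S → f (false ∷ S)) + sumSubsets n (λ S → f (true ∷ S))

prodFin : (n : ℕ) → (Fin n → ℚ) → ℚ
prodFin zero    f = 1ℚ
prodFin (suc n) f = f zero * prodFin n (λ i → f (suc i))

genPoly : (n : ℕ) → (Vec Bool n → ℚ) → (Fin n → ℚ) → ℚ
genPoly n p z = sumSubsets n (λ S → p S * prodFin n (λ i → if lookup S i then z i else 1ℚ))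

-- pmf polynomial  g(x, x̄) = Σ_S p(S) Π_{i∈S} x_i Π_{i∉S} x̄_i ;
-- variable (i , true) is x_i and (i , false) is x̄_i
pmfPoly : (n : ℕ) → (Vec Bool n → ℚ) → (Fin n × Bool → ℚ) → ℚ
pmfPoly n p x = sumSubsets n (λ S → p S * prodFin n (λ i → x (i , lookup S i)))

-- Write f for the generating polynomial and, for a scalar λ, z_i(λ) = λ x_i / (1 + λ x̄_i).
-- Every monomial Π_{i∈S} z_i of f, multiplied by Π_i (1 + λ x̄_i), becomes
-- Π_{i∈S} λ x_i Π_{i∉S} (1 + λ x̄_i), whose coefficient of λ^n is Π_{i∈S} x_i Π_{i∉S} x̄_i.
-- So the pmf polynomial is the coefficient of λ^n in Π_i (1 + λ x̄_i) · f(z(λ)). Division is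
-- avoided by truncating 1/(1 + λ x̄_i) to its first n geometric terms, which only changes
-- coefficients of λ^(n+1) and higher; the result is then a polynomial in λ of degree at most
-- n(n+1), so its coefficient of λ^n is a fixed linear combination (Lagrange interpolation) of its
-- values at λ = 0, 1, …, n(n+1), each of which costs one copy of the given circuit plus O(n²)
-- gates.

module Submission where

open import Defs
open import Data.Nat using (ℕ; suc)
open import Data.Fin using (Fin)

module Rationals where
  open import Data.Nat using (ℕ; zero; suc)
  import Data.Nat.Coprimality as Coprimality
  open import Data.Fin using (Fin; zero; suc; punchIn)
  open import Data.Fin.Properties using (punchInᵢ≢i)
  import Data.Integer as ℤ
  open import Data.Rational using (ℚ; mkℚ; 0ℚ; 1ℚ; _+_; _*_; _-_; 1/_; ≢-nonZero)
  open import Data.Rational.Properties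
    using ( +-*-commutativeRing; _≟_; +-identityˡ; +-identityʳ; +-inverseʳ
          ; *-identityˡ; *-zeroˡ; *-zeroʳ; *-assoc; *-inverseˡ)
  open import Data.Vec.Functional using (removeAt; replicate)
  open import Algebra.Bundles using (CommutativeRing)
  open import Function using (_∘_)
  open import Relation.Binary.PropositionalEquality
  open import Relation.Nullary.Decidable.Core using (dec⇒maybe)
  open import Tactic.RingSolver using (solve-∀)
  open import Tactic.RingSolver.Core.AlmostCommutativeRing
    using (AlmostCommutativeRing; fromCommutativeRing)

  open import Algebra.Properties.CommutativeSemiring.Exp
    (CommutativeRing.commutativeSemiring +-*-commutativeRing) public
    using (_^_; ^-distrib-*)
  open import Algebra.Properties.Semiring.Sum (CommutativeRing.semiring +-*-commutativeRing) public
    using (sum; sum-cong-≗; sum-remove; sum-replicate-zero; *-distribˡ-sum; ∑-distrib-+)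

  ℚ-ring : AlmostCommutativeRing _ _
  ℚ-ring = fromCommutativeRing +-*-commutativeRing (λ x → dec⇒maybe (0ℚ ≟ x))

  x≢0∧x*y≡0⇒y≡0 : ∀ {x y} → x ≢ 0ℚ → x * y ≡ 0ℚ → y ≡ 0ℚ
  x≢0∧x*y≡0⇒y≡0 {x} {y} x≢0 xy≡0 = begin
    y               ≡⟨ *-identityˡ y ⟨
    1ℚ * y          ≡⟨ cong (_* y) (*-inverseˡ x) ⟨
    (1/ x * x) * y  ≡⟨ *-assoc (1/ x) x y ⟩
    1/ x * (x * y)  ≡⟨ cong (1/ x *_) xy≡0 ⟩
    1/ x * 0ℚ       ≡⟨ *-zeroʳ (1/ x) ⟩
    0ℚ              ∎
    where
    open ≡-Reasoning
    instance _ = ≢-nonZero x≢0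

  x*y≢0 : ∀ {x y} → x ≢ 0ℚ → y ≢ 0ℚ → x * y ≢ 0ℚ
  x*y≢0 x≢0 y≢0 = y≢0 ∘ x≢0∧x*y≡0⇒y≡0 x≢0

  x≢y⇒x-y≢0 : ∀ {x y} → x ≢ y → x - y ≢ 0ℚ
  x≢y⇒x-y≢0 {x} {y} x≢y x-y≡0 = x≢y (begin
    x            ≡⟨ x≡[x-y]+y x y ⟩
    (x - y) + y  ≡⟨ cong (_+ y) x-y≡0 ⟩
    0ℚ + y       ≡⟨ +-identityˡ y ⟩
    y            ∎)
    where
    open ≡-Reasoning
    x≡[x-y]+y : ∀ x y → x ≡ (x - y) + y
    x≡[x-y]+y = solve-∀ ℚ-ring

  fromℕ : ℕ → ℚ
  fromℕ m = mkℚ (ℤ.+ m) 0 (Coprimality.sym (Coprimality.1-coprimeTo m))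

  fromℕ-injective : ∀ {i j} → fromℕ i ≡ fromℕ j → i ≡ j
  fromℕ-injective refl = refl

  prodFin-cong : ∀ m {f g : Fin m → ℚ} → (∀ i → f i ≡ g i) → prodFin m f ≡ prodFin m g
  prodFin-cong zero    f≗g = refl
  prodFin-cong (suc m) f≗g = cong₂ _*_ (f≗g zero) (prodFin-cong m (f≗g ∘ suc))

  prodFin-* : ∀ m (f g : Fin m → ℚ) → prodFin m f * prodFin m g ≡ prodFin m (λ i → f i * g i)
  prodFin-* zero    f g = *-identityˡ 1ℚ
  prodFin-* (suc m) f g = begin
    (f zero * F) * (g zero * G)  ≡⟨ interchange (f zero) (g zero) F G ⟩
    (f zero * g zero) * (F * G)  ≡⟨ cong (f zero * g zero *_) (prodFin-* m (f ∘ suc) (g ∘ suc)) ⟩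
    (f zero * g zero) * prodFin m (λ i → f (suc i) * g (suc i)) ∎
    where
    open ≡-Reasoning
    F = prodFin m (f ∘ suc)
    G = prodFin m (g ∘ suc)
    interchange : ∀ a b c d → (a * c) * (b * d) ≡ (a * b) * (c * d)
    interchange = solve-∀ ℚ-ring

  prodFin-≡0 : ∀ m {f : Fin m → ℚ} i → f i ≡ 0ℚ → prodFin m f ≡ 0ℚ
  prodFin-≡0 (suc m) {f} zero    fi≡0 =
    trans (cong (_* prodFin m (f ∘ suc)) fi≡0) (*-zeroˡ (prodFin m (f ∘ suc)))
  prodFin-≡0 (suc m) {f} (suc i) fi≡0 =
    trans (cong (f zero *_) (prodFin-≡0 m i fi≡0)) (*-zeroʳ (f zero))

  prodFin-≢0 : ∀ m {f : Fin m → ℚ} → (∀ i → f i ≢ 0ℚ) → prodFin m f ≢ 0ℚ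
  prodFin-≢0 zero    f≢0 ()
  prodFin-≢0 (suc m) f≢0 = x*y≢0 (f≢0 zero) (prodFin-≢0 m (f≢0 ∘ suc))

  sum-δ : ∀ {m} (t : Fin m → ℚ) i → (∀ j → j ≢ i → t j ≡ 0ℚ) → sum t ≡ t i
  sum-δ {suc m} t i t≡0 = begin
    sum t                       ≡⟨ sum-remove {i = i} t ⟩
    t i + sum (removeAt t i)    ≡⟨ cong (t i +_) (sum-cong-≗ (λ k → t≡0 (punchIn i k) (punchInᵢ≢i i k))) ⟩
    t i + sum (replicate m 0ℚ)  ≡⟨ cong (t i +_) (sum-replicate-zero m) ⟩
    t i + 0ℚ                    ≡⟨ +-identityʳ (t i) ⟩
    t i                         ∎
    where open ≡-Reasoning

  geometric : ℚ → ℕ → ℚ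
  geometric q zero    = 0ℚ
  geometric q (suc t) = 1ℚ + q * geometric q t

  geometric-closed : ∀ q t → (1ℚ - q) * geometric q t ≡ 1ℚ - q ^ t
  geometric-closed q zero    = trans (*-zeroʳ (1ℚ - q)) (sym (+-inverseʳ 1ℚ))
  geometric-closed q (suc t) = begin
    (1ℚ - q) * (1ℚ + q * geometric q t)        ≡⟨ expand q (geometric q t) ⟩
    (1ℚ - q) + q * ((1ℚ - q) * geometric q t)  ≡⟨ cong (λ u → (1ℚ - q) + q * u) (geometric-closed q t) ⟩
    (1ℚ - q) + q * (1ℚ - q ^ t)                ≡⟨ telescope q (q ^ t) ⟩
    1ℚ - q * q ^ t                             ∎
    where
    open ≡-Reasoning
    expand : ∀ q g → (1ℚ - q) * (1ℚ + q * g) ≡ (1ℚ - q) + q * ((1ℚ - q) * g)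
    expand = solve-∀ ℚ-ring
    telescope : ∀ q r → (1ℚ - q) + q * (1ℚ - r) ≡ 1ℚ - q * r
    telescope = solve-∀ ℚ-ring

module SubsetSums where
  open import Data.Nat using (zero; suc)
  open import Data.Fin using (Fin)
  open import Data.Bool using (Bool; true; false)
  open import Data.Vec using (Vec; []; _∷_)
  open import Data.Rational using (ℚ; _+_; _*_)
  open import Data.Rational.Properties using (*-distribˡ-+)
  open import Function using (_∘_)
  open import Relation.Binary.PropositionalEquality
  open Rationals using (sum; ∑-distrib-+)

  sumSubsets-cong : ∀ n {f g : Vec Bool n → ℚ} → (∀ S → f S ≡ g S) → sumSubsets n f ≡ sumSubsets n g
  sumSubsets-cong zero    f≗g = f≗g []
  sumSubsets-cong (suc n) f≗g =
    cong₂ _+_ (sumSubsets-cong n (λ S → f≗g (false ∷ S))) (sumSubsets-cong n (λ S → f≗g (true ∷ S)))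

  *-distribˡ-sumSubsets : ∀ n c (f : Vec Bool n → ℚ) → c * sumSubsets n f ≡ sumSubsets n (λ S → c * f S)
  *-distribˡ-sumSubsets zero    c f = refl
  *-distribˡ-sumSubsets (suc n) c f = trans (*-distribˡ-+ c _ _)
    (cong₂ _+_ (*-distribˡ-sumSubsets n c (λ S → f (false ∷ S)))
               (*-distribˡ-sumSubsets n c (λ S → f (true ∷ S))))

  sum-sumSubsets : ∀ {m} n (f : Fin m → Vec Bool n → ℚ) →
                   sum (λ j → sumSubsets n (f j)) ≡ sumSubsets n (λ S → sum (λ j → f j S))
  sum-sumSubsets zero    f = refl
  sum-sumSubsets (suc n) f = begin
    sum (λ j → sumSubsets n (f₀ j) + sumSubsets n (f₁ j))
      ≡⟨ ∑-distrib-+ (sumSubsets n ∘ f₀) (sumSubsets n ∘ f₁) ⟩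
    sum (λ j → sumSubsets n (f₀ j)) + sum (λ j → sumSubsets n (f₁ j))
      ≡⟨ cong₂ _+_ (sum-sumSubsets n f₀) (sum-sumSubsets n f₁) ⟩
    sumSubsets n (λ S → sum (λ j → f₀ j S)) + sumSubsets n (λ S → sum (λ j → f₁ j S)) ∎
    where
    open ≡-Reasoning
    f₀ f₁ : Fin _ → Vec Bool n → ℚ
    f₀ j S = f j (false ∷ S)
    f₁ j S = f j (true ∷ S)

module Polynomials where
  open import Data.Nat as ℕ using (ℕ; zero; suc; _≤_; _<_; _⊔_; z≤n; s≤s)
  import Data.Nat.Properties as ℕ
  open import Data.Fin using (Fin; zero; suc)
  open import Data.List using (List; []; _∷_; length; map)
  open import Data.List.Properties using (length-map)
  open import Data.Rational using (ℚ; 0ℚ; 1ℚ; _+_; _*_; -_; _-_)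
  open import Data.Rational.Properties using (+-identityˡ; +-identityʳ; *-zeroʳ; *-identityˡ)
  open import Function using (_∘_)
  open import Relation.Binary.PropositionalEquality
  open import Tactic.RingSolver using (solve-∀)
  open Rationals using (ℚ-ring; _^_; sum)

  -- Coefficient lists, constant term first. Trailing zeros are allowed, so `length` is only a
  -- bound on the degree (plus one).
  Poly : Set
  Poly = List ℚ

  eval : Poly → ℚ → ℚ
  eval []      x = 0ℚ
  eval (c ∷ P) x = c + x * eval P x

  coeff : Poly → ℕ → ℚ
  coeff []      k       = 0ℚ
  coeff (c ∷ P) zero    = c
  coeff (c ∷ P) (suc k) = coeff P k

  infixl 6 _⊕_
  _⊕_ : Poly → Poly → Poly
  []      ⊕ Q       = Q
  (a ∷ P) ⊕ []      = a ∷ P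
  (a ∷ P) ⊕ (b ∷ Q) = a + b ∷ P ⊕ Q

  infixr 7 _⊙_
  _⊙_ : ℚ → Poly → Poly
  c ⊙ P = map (c *_) P

  mulLinear : ℚ → ℚ → Poly → Poly
  mulLinear c l P = c ⊙ P ⊕ (0ℚ ∷ l ⊙ P)

  shift : ℕ → Poly → Poly
  shift zero    P = P
  shift (suc k) P = 0ℚ ∷ shift k P

  sumPoly : ∀ {m} → (Fin m → Poly) → Poly
  sumPoly {zero}  F = []
  sumPoly {suc m} F = F zero ⊕ sumPoly (F ∘ suc)

  rootsPoly : ∀ {m} → (Fin m → ℚ) → Poly
  rootsPoly {zero}  r = 1ℚ ∷ []
  rootsPoly {suc m} r = mulLinear (- r zero) 1ℚ (rootsPoly (r ∘ suc))

  eval-⊕ : ∀ P Q x → eval (P ⊕ Q) x ≡ eval P x + eval Q x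
  eval-⊕ []      Q       x = sym (+-identityˡ (eval Q x))
  eval-⊕ (a ∷ P) []      x = sym (+-identityʳ (eval (a ∷ P) x))
  eval-⊕ (a ∷ P) (b ∷ Q) x =
    trans (cong (λ t → a + b + x * t) (eval-⊕ P Q x)) (regroup a b x (eval P x) (eval Q x))
    where
    regroup : ∀ a b x p q → (a + b) + x * (p + q) ≡ (a + x * p) + (b + x * q)
    regroup = solve-∀ ℚ-ring

  eval-⊙ : ∀ c P x → eval (c ⊙ P) x ≡ c * eval P x
  eval-⊙ c []      x = sym (*-zeroʳ c)
  eval-⊙ c (a ∷ P) x = trans (cong (λ t → c * a + x * t) (eval-⊙ c P x)) (regroup c a x (eval P x))
    where
    regroup : ∀ c a x p → c * a + x * (c * p) ≡ c * (a + x * p)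
    regroup = solve-∀ ℚ-ring

  eval-mulLinear : ∀ c l P x → eval (mulLinear c l P) x ≡ (c + x * l) * eval P x
  eval-mulLinear c l P x = begin
    eval (c ⊙ P ⊕ (0ℚ ∷ l ⊙ P)) x               ≡⟨ eval-⊕ (c ⊙ P) (0ℚ ∷ l ⊙ P) x ⟩
    eval (c ⊙ P) x + (0ℚ + x * eval (l ⊙ P) x)  ≡⟨ cong₂ (λ u v → u + (0ℚ + x * v)) (eval-⊙ c P x) (eval-⊙ l P x) ⟩
    c * p + (0ℚ + x * (l * p))                  ≡⟨ regroup c l x p ⟩
    (c + x * l) * p                             ∎
    where
    open ≡-Reasoning
    p = eval P x
    regroup : ∀ c l x p → c * p + (0ℚ + x * (l * p)) ≡ (c + x * l) * p
    regroup = solve-∀ ℚ-ring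

  eval-shift : ∀ k P x → eval (shift k P) x ≡ x ^ k * eval P x
  eval-shift zero    P x = sym (*-identityˡ (eval P x))
  eval-shift (suc k) P x =
    trans (cong (λ t → 0ℚ + x * t) (eval-shift k P x)) (regroup x (x ^ k) (eval P x))
    where
    regroup : ∀ x y p → 0ℚ + x * (y * p) ≡ (x * y) * p
    regroup = solve-∀ ℚ-ring

  eval-sumPoly : ∀ {m} (F : Fin m → Poly) x → eval (sumPoly F) x ≡ sum (λ j → eval (F j) x)
  eval-sumPoly {zero}  F x = refl
  eval-sumPoly {suc m} F x =
    trans (eval-⊕ (F zero) (sumPoly (F ∘ suc)) x) (cong (eval (F zero) x +_) (eval-sumPoly (F ∘ suc) x))

  eval-rootsPoly : ∀ {m} (r : Fin m → ℚ) x → eval (rootsPoly r) x ≡ prodFin m (λ i → x - r i)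
  eval-rootsPoly {zero}  r x = trans (cong (1ℚ +_) (*-zeroʳ x)) (+-identityʳ 1ℚ)
  eval-rootsPoly {suc m} r x = begin
    eval (mulLinear (- r zero) 1ℚ R) x                 ≡⟨ eval-mulLinear (- r zero) 1ℚ R x ⟩
    (- r zero + x * 1ℚ) * eval R x                     ≡⟨ cong₂ _*_ (linear (r zero) x) (eval-rootsPoly (r ∘ suc) x) ⟩
    (x - r zero) * prodFin m (λ i → x - r (suc i))     ∎
    where
    open ≡-Reasoning
    R = rootsPoly (r ∘ suc)
    linear : ∀ r x → - r + x * 1ℚ ≡ x - r
    linear = solve-∀ ℚ-ring

  coeff-⊕ : ∀ P Q k → coeff (P ⊕ Q) k ≡ coeff P k + coeff Q k
  coeff-⊕ []      Q       k       = sym (+-identityˡ (coeff Q k))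
  coeff-⊕ (a ∷ P) []      k       = sym (+-identityʳ (coeff (a ∷ P) k))
  coeff-⊕ (a ∷ P) (b ∷ Q) zero    = refl
  coeff-⊕ (a ∷ P) (b ∷ Q) (suc k) = coeff-⊕ P Q k

  coeff-⊙ : ∀ c P k → coeff (c ⊙ P) k ≡ c * coeff P k
  coeff-⊙ c []      k       = sym (*-zeroʳ c)
  coeff-⊙ c (a ∷ P) zero    = refl
  coeff-⊙ c (a ∷ P) (suc k) = coeff-⊙ c P k

  coeff-mulLinear-zero : ∀ c l P → coeff (mulLinear c l P) 0 ≡ c * coeff P 0
  coeff-mulLinear-zero c l P =
    trans (coeff-⊕ (c ⊙ P) (0ℚ ∷ l ⊙ P) 0) (trans (+-identityʳ _) (coeff-⊙ c P 0))

  coeff-mulLinear-suc : ∀ c l P k → coeff (mulLinear c l P) (suc k) ≡ c * coeff P (suc k) + l * coeff P k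
  coeff-mulLinear-suc c l P k =
    trans (coeff-⊕ (c ⊙ P) (0ℚ ∷ l ⊙ P) (suc k)) (cong₂ _+_ (coeff-⊙ c P (suc k)) (coeff-⊙ l P k))

  coeff-shift : ∀ {k j} P → j < k → coeff (shift k P) j ≡ 0ℚ
  coeff-shift {suc k} {zero}  P _         = refl
  coeff-shift {suc k} {suc j} P (s≤s j<k) = coeff-shift P j<k

  coeff-sumPoly : ∀ {m} (F : Fin m → Poly) k → coeff (sumPoly F) k ≡ sum (λ j → coeff (F j) k)
  coeff-sumPoly {zero}  F k = refl
  coeff-sumPoly {suc m} F k =
    trans (coeff-⊕ (F zero) (sumPoly (F ∘ suc)) k) (cong (coeff (F zero) k +_) (coeff-sumPoly (F ∘ suc) k))

  coeff-length : ∀ {k} P → length P ≤ k → coeff P k ≡ 0ℚ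
  coeff-length         []      _           = refl
  coeff-length {suc k} (a ∷ P) (s≤s |P|≤k) = coeff-length P |P|≤k

  length-⊕ : ∀ P Q → length (P ⊕ Q) ≡ length P ⊔ length Q
  length-⊕ []      Q       = refl
  length-⊕ (a ∷ P) []      = sym (ℕ.⊔-identityʳ (length (a ∷ P)))
  length-⊕ (a ∷ P) (b ∷ Q) = cong suc (length-⊕ P Q)

  length-⊙ : ∀ c P → length (c ⊙ P) ≡ length P
  length-⊙ c = length-map (c *_)

  length-mulLinear : ∀ c l P → length (mulLinear c l P) ≡ suc (length P)
  length-mulLinear c l P = begin
    length (c ⊙ P ⊕ (0ℚ ∷ l ⊙ P))          ≡⟨ length-⊕ (c ⊙ P) (0ℚ ∷ l ⊙ P) ⟩
    length (c ⊙ P) ⊔ suc (length (l ⊙ P))  ≡⟨ cong₂ (λ u v → u ⊔ suc v) (length-⊙ c P) (length-⊙ l P) ⟩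
    length P ⊔ suc (length P)              ≡⟨ ℕ.m≤n⇒m⊔n≡n (ℕ.n≤1+n (length P)) ⟩
    suc (length P)                         ∎
    where open ≡-Reasoning

  length-shift : ∀ k P → length (shift k P) ≡ k ℕ.+ length P
  length-shift zero    P = refl
  length-shift (suc k) P = cong suc (length-shift k P)

  length-sumPoly : ∀ {m b} (F : Fin m → Poly) → (∀ j → length (F j) ≤ b) → length (sumPoly F) ≤ b
  length-sumPoly {zero}      F |F|≤b = z≤n
  length-sumPoly {suc m} {b} F |F|≤b =
    subst (_≤ b) (sym (length-⊕ (F zero) (sumPoly (F ∘ suc))))
          (ℕ.⊔-lub (|F|≤b zero) (length-sumPoly (F ∘ suc) (|F|≤b ∘ suc)))

  length-rootsPoly : ∀ {m} (r : Fin m → ℚ) → length (rootsPoly r) ≡ suc m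
  length-rootsPoly {zero}  r = refl
  length-rootsPoly {suc m} r =
    trans (length-mulLinear (- r zero) 1ℚ (rootsPoly (r ∘ suc))) (cong suc (length-rootsPoly (r ∘ suc)))

module Interpolation where
  open import Data.Nat as ℕ using (zero; suc; _≤_)
  import Data.Nat.Properties as ℕ
  open import Data.Fin using (Fin; zero; suc; punchOut)
  open import Data.Fin.Properties using (0≢1+n; suc-injective; punchInᵢ≢i; punchIn-punchOut)
  open import Data.List using ([]; _∷_; length)
  open import Data.Vec.Functional using (removeAt)
  open import Data.Rational using (ℚ; 0ℚ; 1ℚ; _+_; _*_; -_; _-_; 1/_; ≢-nonZero)
  open import Data.Rational.Properties
    using (+-identityˡ; +-identityʳ; +-inverseʳ; *-zeroʳ; *-identityʳ; *-inverseˡ)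
  open import Function using (_∘_)
  open import Function.Definitions using (Injective)
  open import Relation.Binary.PropositionalEquality
  open import Tactic.RingSolver using (solve-∀)
  open Rationals
  open Polynomials

  IsZero : Poly → Set
  IsZero P = ∀ k → coeff P k ≡ 0ℚ

  divRoot : ℚ → Poly → Poly
  divRoot a []          = []
  divRoot a (c ∷ [])    = []
  divRoot a (c ∷ d ∷ P) = eval (d ∷ P) a ∷ divRoot a (d ∷ P)

  eval-divRoot : ∀ a P b → eval P b ≡ (b - a) * eval (divRoot a P) b + eval P a
  eval-divRoot a []          b = sym (trans (+-identityʳ _) (*-zeroʳ (b - a)))
  eval-divRoot a (c ∷ [])    b = regroup a b c
    where
    regroup : ∀ a b c → c + b * 0ℚ ≡ (b - a) * 0ℚ + (c + a * 0ℚ)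
    regroup = solve-∀ ℚ-ring
  eval-divRoot a (c ∷ d ∷ P) b =
    trans (cong (λ t → c + b * t) (eval-divRoot a (d ∷ P) b))
          (regroup c b a (eval (divRoot a (d ∷ P)) b) (eval (d ∷ P) a))
    where
    regroup : ∀ c b a q r → c + b * ((b - a) * q + r) ≡ (b - a) * (r + b * q) + (c + a * r)
    regroup = solve-∀ ℚ-ring

  length-divRoot : ∀ a P → length (divRoot a P) ≡ ℕ.pred (length P)
  length-divRoot a []          = refl
  length-divRoot a (c ∷ [])    = refl
  length-divRoot a (c ∷ d ∷ P) = cong suc (length-divRoot a (d ∷ P))

  private
    c≡c+a*0 : ∀ c a → c ≡ c + a * 0ℚ
    c≡c+a*0 c a = sym (trans (cong (c +_) (*-zeroʳ a)) (+-identityʳ c))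

  IsZero-divRoot⇒IsZero : ∀ a P → IsZero (divRoot a P) → eval P a ≡ 0ℚ → IsZero P
  IsZero-divRoot⇒IsZero a []          _   _    k       = refl
  IsZero-divRoot⇒IsZero a (c ∷ [])    _   Pa≡0 zero    = trans (c≡c+a*0 c a) Pa≡0
  IsZero-divRoot⇒IsZero a (c ∷ [])    _   _    (suc k) = refl
  IsZero-divRoot⇒IsZero a (c ∷ d ∷ P) Q≡0 Pa≡0 zero    =
    trans (c≡c+a*0 c a) (trans (cong (λ t → c + a * t) (sym (Q≡0 zero))) Pa≡0)
  IsZero-divRoot⇒IsZero a (c ∷ d ∷ P) Q≡0 _    (suc k) =
    IsZero-divRoot⇒IsZero a (d ∷ P) (Q≡0 ∘ suc) (Q≡0 zero) k

  vanishing⇒IsZero : ∀ {m} (a : Fin m → ℚ) → Injective _≡_ _≡_ a →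
                     ∀ P → length P ≤ m → (∀ i → eval P (a i) ≡ 0ℚ) → IsZero P
  vanishing⇒IsZero {zero}  a a-inj []  _       _      = λ _ → refl
  vanishing⇒IsZero {suc m} a a-inj P   |P|≤1+m P[a]≡0 =
    IsZero-divRoot⇒IsZero (a zero) P
      (vanishing⇒IsZero (a ∘ suc) (suc-injective ∘ a-inj) Q |Q|≤m Q[a]≡0)
      (P[a]≡0 zero)
    where
    Q = divRoot (a zero) P
    |Q|≤m : length Q ≤ m
    |Q|≤m = subst (_≤ m) (sym (length-divRoot (a zero) P)) (ℕ.pred-mono-≤ |P|≤1+m)
    Q[a]≡0 : ∀ i → eval Q (a (suc i)) ≡ 0ℚ
    Q[a]≡0 i = x≢0∧x*y≡0⇒y≡0 (x≢y⇒x-y≢0 (0≢1+n ∘ sym ∘ a-inj)) (begin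
      (b - a zero) * eval Q b                    ≡⟨ +-identityʳ _ ⟨
      (b - a zero) * eval Q b + 0ℚ               ≡⟨ cong ((b - a zero) * eval Q b +_) (P[a]≡0 zero) ⟨
      (b - a zero) * eval Q b + eval P (a zero)  ≡⟨ eval-divRoot (a zero) P b ⟨
      eval P b                                   ≡⟨ P[a]≡0 (suc i) ⟩
      0ℚ                                         ∎)
      where
      open ≡-Reasoning
      b = a (suc i)

  coeff-unique : ∀ {m} (a : Fin m → ℚ) → Injective _≡_ _≡_ a →
                 ∀ P Q → length P ≤ m → length Q ≤ m → (∀ i → eval P (a i) ≡ eval Q (a i)) →
                 ∀ k → coeff P k ≡ coeff Q k
  coeff-unique {m} a a-inj P Q |P|≤m |Q|≤m P≗Q k = begin
    coeff P k                                   ≡⟨ p≡[p-q]+q (coeff P k) (coeff Q k) ⟩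
    (coeff P k + - 1ℚ * coeff Q k) + coeff Q k  ≡⟨ cong (λ t → coeff P k + t + coeff Q k) (coeff-⊙ (- 1ℚ) Q k) ⟨
    (coeff P k + coeff (- 1ℚ ⊙ Q) k) + coeff Q k ≡⟨ cong (_+ coeff Q k) (coeff-⊕ P (- 1ℚ ⊙ Q) k) ⟨
    coeff D k + coeff Q k                       ≡⟨ cong (_+ coeff Q k) (vanishing⇒IsZero a a-inj D |D|≤m D[a]≡0 k) ⟩
    0ℚ + coeff Q k                              ≡⟨ +-identityˡ (coeff Q k) ⟩
    coeff Q k                                   ∎
    where
    open ≡-Reasoning
    D = P ⊕ - 1ℚ ⊙ Q
    p≡[p-q]+q : ∀ p q → p ≡ (p + - 1ℚ * q) + q
    p≡[p-q]+q = solve-∀ ℚ-ring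
    |D|≤m : length D ≤ m
    |D|≤m = subst (_≤ m) (sym (trans (length-⊕ P (- 1ℚ ⊙ Q)) (cong (length P ℕ.⊔_) (length-⊙ (- 1ℚ) Q))))
                  (ℕ.⊔-lub |P|≤m |Q|≤m)
    D[a]≡0 : ∀ i → eval D (a i) ≡ 0ℚ
    D[a]≡0 i = begin
      eval D (a i)                        ≡⟨ eval-⊕ P (- 1ℚ ⊙ Q) (a i) ⟩
      eval P (a i) + eval (- 1ℚ ⊙ Q) (a i) ≡⟨ cong (eval P (a i) +_) (eval-⊙ (- 1ℚ) Q (a i)) ⟩
      eval P (a i) + - 1ℚ * eval Q (a i)  ≡⟨ cong (λ t → t + - 1ℚ * eval Q (a i)) (P≗Q i) ⟩
      eval Q (a i) + - 1ℚ * eval Q (a i)  ≡⟨ q-q≡0 (eval Q (a i)) ⟩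
      0ℚ                                  ∎
      where
      q-q≡0 : ∀ q → q + - 1ℚ * q ≡ 0ℚ
      q-q≡0 = solve-∀ ℚ-ring

  module Lagrange {m} (a : Fin (suc m) → ℚ) (a-inj : Injective _≡_ _≡_ a) where

    denominator : Fin (suc m) → ℚ
    denominator j = prodFin m (λ k → a j - removeAt a j k)

    denominator≢0 : ∀ j → denominator j ≢ 0ℚ
    denominator≢0 j = prodFin-≢0 m (λ k → x≢y⇒x-y≢0 (punchInᵢ≢i j k ∘ a-inj ∘ sym))

    normaliser : Fin (suc m) → ℚ
    normaliser j = (1/ denominator j) {{≢-nonZero (denominator≢0 j)}}

    basis : Fin (suc m) → Poly
    basis j = normaliser j ⊙ rootsPoly (removeAt a j)

    eval-basis : ∀ j x → eval (basis j) x ≡ normaliser j * prodFin m (λ k → x - removeAt a j k)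
    eval-basis j x = trans (eval-⊙ (normaliser j) (rootsPoly (removeAt a j)) x)
                           (cong (normaliser j *_) (eval-rootsPoly (removeAt a j) x))

    eval-basis-same : ∀ j → eval (basis j) (a j) ≡ 1ℚ
    eval-basis-same j = trans (eval-basis j (a j)) (*-inverseˡ (denominator j) {{≢-nonZero (denominator≢0 j)}})

    eval-basis-other : ∀ {i j} → i ≢ j → eval (basis j) (a i) ≡ 0ℚ
    eval-basis-other {i} {j} i≢j = trans (eval-basis j (a i))
      (trans (cong (normaliser j *_) (prodFin-≡0 m k factor≡0)) (*-zeroʳ (normaliser j)))
      where
      k = punchOut (i≢j ∘ sym)
      factor≡0 : a i - removeAt a j k ≡ 0ℚ
      factor≡0 = trans (cong (λ l → a i - a l) (punchIn-punchOut (i≢j ∘ sym))) (+-inverseʳ (a i))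

    length-basis : ∀ j → length (basis j) ≡ suc m
    length-basis j = trans (length-⊙ (normaliser j) (rootsPoly (removeAt a j))) (length-rootsPoly (removeAt a j))

    coeff-lagrange : ∀ P → length P ≤ suc m → ∀ k → coeff P k ≡ sum (λ j → eval P (a j) * coeff (basis j) k)
    coeff-lagrange P |P|≤1+m k = begin
      coeff P k                                     ≡⟨ coeff-unique a a-inj P R |P|≤1+m |R|≤1+m P≗R k ⟩
      coeff R k                                     ≡⟨ coeff-sumPoly F k ⟩
      sum (λ j → coeff (F j) k)                     ≡⟨ sum-cong-≗ (λ j → coeff-⊙ (eval P (a j)) (basis j) k) ⟩
      sum (λ j → eval P (a j) * coeff (basis j) k)  ∎
      where
      open ≡-Reasoning
      F : Fin (suc m) → Poly
      F j = eval P (a j) ⊙ basis j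
      R = sumPoly F
      |R|≤1+m : length R ≤ suc m
      |R|≤1+m = length-sumPoly F (λ j → ℕ.≤-reflexive (trans (length-⊙ (eval P (a j)) (basis j)) (length-basis j)))
      P≗R : ∀ i → eval P (a i) ≡ eval R (a i)
      P≗R i = sym (begin
        eval R (a i)                                     ≡⟨ eval-sumPoly F (a i) ⟩
        sum (λ j → eval (F j) (a i))                     ≡⟨ sum-cong-≗ (λ j → eval-⊙ (eval P (a j)) (basis j) (a i)) ⟩
        sum (λ j → eval P (a j) * eval (basis j) (a i))  ≡⟨ sum-δ _ i other ⟩
        eval P (a i) * eval (basis i) (a i)              ≡⟨ cong (eval P (a i) *_) (eval-basis-same i) ⟩
        eval P (a i) * 1ℚ                                ≡⟨ *-identityʳ (eval P (a i)) ⟩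
        eval P (a i)                                     ∎)
        where
        other : ∀ j → j ≢ i → eval P (a j) * eval (basis j) (a i) ≡ 0ℚ
        other j j≢i = trans (cong (eval P (a j) *_) (eval-basis-other (j≢i ∘ sym))) (*-zeroʳ (eval P (a j)))

module TrinomialProducts where
  open import Data.Nat as ℕ using (ℕ; zero; suc; _<_; s≤s)
  import Data.Nat.Properties as ℕ
  open import Data.Fin using (Fin; zero; suc)
  open import Data.List using ([]; _∷_; length)
  open import Data.Rational using (ℚ; 0ℚ; 1ℚ; _+_; _*_)
  open import Data.Rational.Properties using (+-identityʳ; *-zeroʳ)
  open import Function using (_∘_)
  open import Relation.Binary.PropositionalEquality
  open import Tactic.RingSolver using (solve-∀)
  open Rationals
  open Polynomials

  AgreeBelow : ℕ → Poly → Poly → Set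
  AgreeBelow N P Q = ∀ k → k < N → coeff P k ≡ coeff Q k

  mulLinear-agreeBelow : ∀ {N} c l P Q → AgreeBelow N P Q → AgreeBelow N (mulLinear c l P) (mulLinear c l Q)
  mulLinear-agreeBelow c l P Q P≈Q zero    0<N = begin
    coeff (mulLinear c l P) 0  ≡⟨ coeff-mulLinear-zero c l P ⟩
    c * coeff P 0              ≡⟨ cong (c *_) (P≈Q 0 0<N) ⟩
    c * coeff Q 0              ≡⟨ coeff-mulLinear-zero c l Q ⟨
    coeff (mulLinear c l Q) 0  ∎
    where open ≡-Reasoning
  mulLinear-agreeBelow c l P Q P≈Q (suc k) 1+k<N = begin
    coeff (mulLinear c l P) (suc k)      ≡⟨ coeff-mulLinear-suc c l P k ⟩
    c * coeff P (suc k) + l * coeff P k  ≡⟨ cong₂ (λ u v → c * u + l * v) (P≈Q (suc k) 1+k<N) (P≈Q k k<N) ⟩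
    c * coeff Q (suc k) + l * coeff Q k  ≡⟨ coeff-mulLinear-suc c l Q k ⟨
    coeff (mulLinear c l Q) (suc k)      ∎
    where
    open ≡-Reasoning
    k<N = ℕ.<-trans (ℕ.n<1+n k) 1+k<N

  linearProduct : ∀ m → (Fin m → ℚ) → (Fin m → ℚ) → Poly
  linearProduct zero    c l = 1ℚ ∷ []
  linearProduct (suc m) c l = mulLinear (c zero) (l zero) (linearProduct m (c ∘ suc) (l ∘ suc))

  length-linearProduct : ∀ m c l → length (linearProduct m c l) ≡ suc m
  length-linearProduct zero    c l = refl
  length-linearProduct (suc m) c l = trans (length-mulLinear (c zero) (l zero) (linearProduct m (c ∘ suc) (l ∘ suc)))
                                           (cong suc (length-linearProduct m (c ∘ suc) (l ∘ suc)))

  coeff-linearProduct : ∀ m c l → coeff (linearProduct m c l) m ≡ prodFin m l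
  coeff-linearProduct zero    c l = refl
  coeff-linearProduct (suc m) c l = begin
    coeff (mulLinear (c zero) (l zero) P) (suc m)  ≡⟨ coeff-mulLinear-suc (c zero) (l zero) P m ⟩
    c zero * coeff P (suc m) + l zero * coeff P m
      ≡⟨ cong₂ (λ u v → c zero * u + l zero * v) top≡0 (coeff-linearProduct m (c ∘ suc) (l ∘ suc)) ⟩
    c zero * 0ℚ + l zero * prodFin m (l ∘ suc)     ≡⟨ drop-zero (c zero) (l zero * prodFin m (l ∘ suc)) ⟩
    l zero * prodFin m (l ∘ suc)                   ∎
    where
    open ≡-Reasoning
    P = linearProduct m (c ∘ suc) (l ∘ suc)
    top≡0 : coeff P (suc m) ≡ 0ℚ
    top≡0 = coeff-length P (ℕ.≤-reflexive (length-linearProduct m (c ∘ suc) (l ∘ suc)))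
    drop-zero : ∀ a b → a * 0ℚ + b ≡ b
    drop-zero = solve-∀ ℚ-ring

  trinomialProduct : ℕ → ∀ m → (Fin m → ℚ) → (Fin m → ℚ) → (Fin m → ℚ) → Poly
  trinomialProduct N zero    c l e = 1ℚ ∷ []
  trinomialProduct N (suc m) c l e = mulLinear (c zero) (l zero) P ⊕ e zero ⊙ shift N P
    where P = trinomialProduct N m (c ∘ suc) (l ∘ suc) (e ∘ suc)

  eval-trinomialProduct : ∀ N m c l e x →
    eval (trinomialProduct N m c l e) x ≡ prodFin m (λ i → c i + x * l i + x ^ N * e i)
  eval-trinomialProduct N zero    c l e x = trans (cong (1ℚ +_) (*-zeroʳ x)) (+-identityʳ 1ℚ)
  eval-trinomialProduct N (suc m) c l e x = begin
    eval (M ⊕ e zero ⊙ shift N P) x                  ≡⟨ eval-⊕ M (e zero ⊙ shift N P) x ⟩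
    eval M x + eval (e zero ⊙ shift N P) x           ≡⟨ cong (eval M x +_) (eval-⊙ (e zero) (shift N P) x) ⟩
    eval M x + e zero * eval (shift N P) x
      ≡⟨ cong₂ (λ u v → u + e zero * v) (eval-mulLinear (c zero) (l zero) P x) (eval-shift N P x) ⟩
    (c zero + x * l zero) * p + e zero * (x ^ N * p) ≡⟨ factor (c zero) (l zero) (e zero) x (x ^ N) p ⟩
    f zero * p
      ≡⟨ cong (f zero *_) (eval-trinomialProduct N m (c ∘ suc) (l ∘ suc) (e ∘ suc) x) ⟩
    f zero * prodFin m (f ∘ suc)                     ∎
    where
    open ≡-Reasoning
    P = trinomialProduct N m (c ∘ suc) (l ∘ suc) (e ∘ suc)
    M = mulLinear (c zero) (l zero) P
    p = eval P x
    f = λ i → c i + x * l i + x ^ N * e i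
    factor : ∀ c l e x y p → (c + x * l) * p + e * (y * p) ≡ (c + x * l + y * e) * p
    factor = solve-∀ ℚ-ring

  length-trinomialProduct : ∀ N m c l e → length (trinomialProduct (suc N) m c l e) ≡ suc (m ℕ.* suc N)
  length-trinomialProduct N zero    c l e = refl
  length-trinomialProduct N (suc m) c l e = begin
    length (M ⊕ e zero ⊙ shift (suc N) P)                   ≡⟨ length-⊕ M (e zero ⊙ shift (suc N) P) ⟩
    length M ℕ.⊔ length (e zero ⊙ shift (suc N) P)          ≡⟨ cong₂ ℕ._⊔_ (length-mulLinear (c zero) (l zero) P)
                                                                          (length-⊙ (e zero) (shift (suc N) P)) ⟩
    suc (length P) ℕ.⊔ length (shift (suc N) P)             ≡⟨ cong (suc (length P) ℕ.⊔_) (length-shift (suc N) P) ⟩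
    suc (length P) ℕ.⊔ (suc N ℕ.+ length P)                 ≡⟨ ℕ.m≤n⇒m⊔n≡n (s≤s (ℕ.m≤n+m (length P) N)) ⟩
    suc N ℕ.+ length P
      ≡⟨ cong (suc N ℕ.+_) (length-trinomialProduct N m (c ∘ suc) (l ∘ suc) (e ∘ suc)) ⟩
    suc N ℕ.+ suc (m ℕ.* suc N)                             ≡⟨ ℕ.+-suc (suc N) (m ℕ.* suc N) ⟩
    suc (suc m ℕ.* suc N)                                   ∎
    where
    open ≡-Reasoning
    P = trinomialProduct (suc N) m (c ∘ suc) (l ∘ suc) (e ∘ suc)
    M = mulLinear (c zero) (l zero) P

  trinomialProduct-agreeBelow : ∀ N m c l e → AgreeBelow N (trinomialProduct N m c l e) (linearProduct m c l)
  trinomialProduct-agreeBelow N zero    c l e k k<N = refl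
  trinomialProduct-agreeBelow N (suc m) c l e k k<N = begin
    coeff (M ⊕ e zero ⊙ shift N P) k          ≡⟨ coeff-⊕ M (e zero ⊙ shift N P) k ⟩
    coeff M k + coeff (e zero ⊙ shift N P) k  ≡⟨ cong (coeff M k +_) (coeff-⊙ (e zero) (shift N P) k) ⟩
    coeff M k + e zero * coeff (shift N P) k  ≡⟨ cong (λ t → coeff M k + e zero * t) (coeff-shift P k<N) ⟩
    coeff M k + e zero * 0ℚ                   ≡⟨ cong (coeff M k +_) (*-zeroʳ (e zero)) ⟩
    coeff M k + 0ℚ                            ≡⟨ +-identityʳ (coeff M k) ⟩
    coeff M k                                 ≡⟨ mulLinear-agreeBelow (c zero) (l zero) P L P≈L k k<N ⟩
    coeff (linearProduct (suc m) c l) k       ∎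
    where
    open ≡-Reasoning
    P = trinomialProduct N m (c ∘ suc) (l ∘ suc) (e ∘ suc)
    L = linearProduct m (c ∘ suc) (l ∘ suc)
    M = mulLinear (c zero) (l zero) P
    P≈L = trinomialProduct-agreeBelow N m (c ∘ suc) (l ∘ suc) (e ∘ suc)

  coeff-trinomialProduct : ∀ N m c l e → m < N → coeff (trinomialProduct N m c l e) m ≡ prodFin m l
  coeff-trinomialProduct N m c l e m<N =
    trans (trinomialProduct-agreeBelow N m c l e m m<N) (coeff-linearProduct m c l)

module Circuits where
  open import Data.Nat as ℕ using (ℕ; zero; suc; _+_; _*_; _≤_; z≤n; s≤s)
  import Data.Nat.Properties as ℕ
  open import Data.Nat.Tactic.RingSolver using (solve-∀)
  open import Data.Fin using (Fin; zero; suc; fromℕ; inject₁)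
  open import Data.Fin.Relation.Unary.Top using (View; view; ‵fromℕ; ‵inj₁)
  open import Data.List using ([]; _∷_; map)
  open import Data.List.Properties using (length-map)
  open import Data.Vec using (Vec; []; _∷_; lookup; _∷ʳ_)
  open import Data.Product using (_,_; map₂)
  open import Data.Rational as ℚ using (ℚ; 1ℚ)
  open import Data.Rational.Properties using (+-identityʳ; *-identityˡ)
  open import Function using (_∘_; id)
  open import Relation.Binary.PropositionalEquality

  lookup-∷ʳ-inject₁ : ∀ {A : Set} {m} (xs : Vec A m) y j → lookup (xs ∷ʳ y) (inject₁ j) ≡ lookup xs j
  lookup-∷ʳ-inject₁ (x ∷ xs) y zero    = refl
  lookup-∷ʳ-inject₁ (x ∷ xs) y (suc j) = lookup-∷ʳ-inject₁ xs y j

  lookup-∷ʳ-fromℕ : ∀ {A : Set} {m} (xs : Vec A m) y → lookup (xs ∷ʳ y) (fromℕ m) ≡ y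
  lookup-∷ʳ-fromℕ []       y = refl
  lookup-∷ʳ-fromℕ (x ∷ xs) y = lookup-∷ʳ-fromℕ xs y

  value : ∀ {V m} → Circuit V m → (V → ℚ) → Fin m → ℚ
  value D a = lookup (evalAll D a)

  value-inject₁ : ∀ {V m} (D : Circuit V m) g a j → value (D ▷ g) a (inject₁ j) ≡ value D a j
  value-inject₁ D g a = lookup-∷ʳ-inject₁ (evalAll D a) _

  value-fromℕ : ∀ {V m} (D : Circuit V m) g a → value (D ▷ g) a (fromℕ m) ≡ evalGate g (evalAll D a) a
  value-fromℕ D g a = lookup-∷ʳ-fromℕ (evalAll D a) _

  output≡value-fromℕ : ∀ {V m} (D : Circuit V (suc m)) a → output D a ≡ value D a (fromℕ m)
  output≡value-fromℕ (D ▷ g) a = sym (value-fromℕ D g a)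

  size-positive : ∀ {V m} (D : Circuit V (suc m)) → 1 ≤ size D
  size-positive (D ▷ g) = s≤s z≤n

  module _ {W : Set} where

    record _⊑_ {m m′} (D : Circuit W m) (D′ : Circuit W m′) : Set where
      field
        embed       : Fin m → Fin m′
        embed-value : ∀ a j → value D′ a (embed j) ≡ value D a j

    ⊑-refl : ∀ {m} {D : Circuit W m} → D ⊑ D
    ⊑-refl = record { embed = id ; embed-value = λ _ _ → refl }

    ⊑-trans : ∀ {m m′ m″} {D : Circuit W m} {D′ : Circuit W m′} {D″ : Circuit W m″} →
              D ⊑ D′ → D′ ⊑ D″ → D ⊑ D″
    ⊑-trans D⊑D′ D′⊑D″ = record
      { embed       = D′⊑D″.embed ∘ D⊑D′.embed
      ; embed-value = λ a j → trans (D′⊑D″.embed-value a (D⊑D′.embed j)) (D⊑D′.embed-value a j)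
      }
      where
      module D⊑D′ = _⊑_ D⊑D′
      module D′⊑D″ = _⊑_ D′⊑D″

    ⊑-▷ : ∀ {m} {D : Circuit W m} {g} → D ⊑ (D ▷ g)
    ⊑-▷ {D = D} {g} = record { embed = inject₁ ; embed-value = value-inject₁ D g }

    -- An input gate becomes a one-term sum over the gate supplying that input; this is the
    -- only gate whose fan-in grows, whence the factor 2 in `Copy.size-≤`.
    translate : ∀ {V k m} → (V → Fin m) → (Fin k → Fin m) → Gate V k → Gate W m
    translate ι σ (var v)   = add ((1ℚ , ι v) ∷ [])
    translate ι σ (const q) = const q
    translate ι σ (add xs)  = add (map (map₂ σ) xs)
    translate ι σ (mul xs)  = mul (map σ xs)

    fanin-translate : ∀ {V k m} (ι : V → Fin m) (σ : Fin k → Fin m) g → fanin (translate ι σ g) ≤ suc (fanin g)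
    fanin-translate ι σ (var v)   = s≤s z≤n
    fanin-translate ι σ (const q) = z≤n
    fanin-translate ι σ (add xs)  = ℕ.≤-trans (ℕ.≤-reflexive (length-map (map₂ σ) xs)) (ℕ.n≤1+n _)
    fanin-translate ι σ (mul xs)  = ℕ.≤-trans (ℕ.≤-reflexive (length-map σ xs)) (ℕ.n≤1+n _)

    evalGate-translate : ∀ {V k m} (ι : V → Fin m) (σ : Fin k → Fin m) g vs vs′ (a : W → ℚ) (z : V → ℚ) →
                         (∀ j → lookup vs′ (σ j) ≡ lookup vs j) → (∀ v → lookup vs′ (ι v) ≡ z v) →
                         evalGate (translate ι σ g) vs′ a ≡ evalGate g vs z
    evalGate-translate ι σ (var v)   vs vs′ a z σ-ok ι-ok = trans (+-identityʳ _) (trans (*-identityˡ _) (ι-ok v))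
    evalGate-translate ι σ (const q) vs vs′ a z σ-ok ι-ok = refl
    evalGate-translate ι σ (add xs)  vs vs′ a z σ-ok ι-ok = sums xs
      where
      sums : ∀ xs → evalGate (add (map (map₂ σ) xs)) vs′ a ≡ evalGate (add xs) vs z
      sums []             = refl
      sums ((w , j) ∷ xs) = cong₂ (λ u v → w ℚ.* u ℚ.+ v) (σ-ok j) (sums xs)
    evalGate-translate ι σ (mul xs)  vs vs′ a z σ-ok ι-ok = products xs
      where
      products : ∀ xs → evalGate (mul (map σ xs)) vs′ a ≡ evalGate (mul xs) vs z
      products []       = refl
      products (j ∷ xs) = cong₂ ℚ._*_ (σ-ok j) (products xs)

    record Copy {V k m} (C : Circuit V k) (D : Circuit W m) (ι : V → Fin m) : Set where
      field
        m′         : ℕ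
        circuit    : Circuit W m′
        extends    : D ⊑ circuit
        gate       : Fin k → Fin m′
        gate-value : ∀ a z → (∀ v → value D a (ι v) ≡ z v) → ∀ j → value circuit a (gate j) ≡ value C z j
        size-≤     : size circuit ≤ 2 * size C + size D

      open _⊑_ extends public

      translateGate : Gate V k → Gate W m′
      translateGate = translate (embed ∘ ι) gate

      evalGate-translateGate : ∀ g a z → (∀ v → value D a (ι v) ≡ z v) →
                               evalGate (translateGate g) (evalAll circuit a) a ≡ evalGate g (evalAll C z) z
      evalGate-translateGate g a z ι-ok =
        evalGate-translate (embed ∘ ι) gate g (evalAll C z) (evalAll circuit a) a z
          (gate-value a z ι-ok) (λ v → trans (embed-value a (ι v)) (ι-ok v))

      size-▷-translateGate : ∀ g → size (circuit ▷ translateGate g) ≤ 2 * size (C ▷ g) + size D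
      size-▷-translateGate g = begin
        suc (fanin (translateGate g) + size circuit)
          ≤⟨ s≤s (ℕ.+-mono-≤ (fanin-translate (embed ∘ ι) gate g) size-≤) ⟩
        suc (suc (fanin g) + (2 * size C + size D))            ≤⟨ ℕ.m≤m+n _ (fanin g) ⟩
        suc (suc (fanin g) + (2 * size C + size D)) + fanin g  ≡⟨ regroup (fanin g) (size C) (size D) ⟩
        2 * suc (fanin g + size C) + size D                    ∎
        where
        open ℕ.≤-Reasoning
        regroup : ∀ f s d → suc (suc f + (2 * s + d)) + f ≡ 2 * suc (f + s) + d
        regroup = solve-∀

    extendGate : ∀ {k m} → (Fin k → Fin m) → {j : Fin (suc k)} → View j → Fin (suc m)
    extendGate σ ‵fromℕ            = fromℕ _
    extendGate σ (‵inj₁ {i = i} _) = inject₁ (σ i)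

    copy : ∀ {V k m} (C : Circuit V k) (D : Circuit W m) (ι : V → Fin m) → Copy C D ι
    copy [] D ι = record
      { circuit = D ; extends = ⊑-refl ; gate = λ () ; gate-value = λ _ _ _ () ; size-≤ = ℕ.≤-refl }
    copy (C ▷ g) D ι = record
      { circuit    = Q.circuit ▷ g′
      ; extends    = ⊑-trans Q.extends ⊑-▷
      ; gate       = λ j → extendGate Q.gate (view j)
      ; gate-value = λ a z ι-ok j → gate-value a z ι-ok (view j)
      ; size-≤     = Q.size-▷-translateGate g
      }
      where
      open ≡-Reasoning
      module Q = Copy (copy C D ι)
      g′ = Q.translateGate g
      gate-value : ∀ a z → (∀ v → value D a (ι v) ≡ z v) → ∀ {j} (v : View j) →
                   value (Q.circuit ▷ g′) a (extendGate Q.gate v) ≡ value (C ▷ g) z j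
      gate-value a z ι-ok ‵fromℕ = begin
        value (Q.circuit ▷ g′) a (fromℕ _)  ≡⟨ value-fromℕ Q.circuit g′ a ⟩
        evalGate g′ (evalAll Q.circuit a) a ≡⟨ Q.evalGate-translateGate g a z ι-ok ⟩
        evalGate g (evalAll C z) z          ≡⟨ value-fromℕ C g z ⟨
        value (C ▷ g) z (fromℕ _)           ∎
      gate-value a z ι-ok (‵inj₁ {i = i} _) = begin
        value (Q.circuit ▷ g′) a (inject₁ (Q.gate i))  ≡⟨ value-inject₁ Q.circuit g′ a (Q.gate i) ⟩
        value Q.circuit a (Q.gate i)                   ≡⟨ Q.gate-value a z ι-ok i ⟩
        value C z i                                    ≡⟨ value-inject₁ C g z i ⟨
        value (C ▷ g) z (inject₁ i)                    ∎

module Expressions where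
  open import Data.Nat as ℕ using (ℕ; zero; suc; _+_; _*_; _≤_; s≤s)
  import Data.Nat.Properties as ℕ
  open import Data.Nat.Tactic.RingSolver using (solve-∀)
  open import Data.Fin using (Fin; zero; suc; fromℕ)
  open import Data.List using ([]; _∷_)
  open import Data.Vec.Functional using (foldr)
  open import Data.Product using (_,_)
  open import Data.Rational as ℚ using (ℚ; 0ℚ; 1ℚ)
  open import Data.Rational.Properties using (+-identityʳ; *-identityʳ)
  open import Function using (_∘_)
  open import Relation.Binary.PropositionalEquality
  open Circuits

  data Expr (W : Set) : Set where
    input    : W → Expr W
    constant : ℚ → Expr W
    lin      : ℚ → Expr W → ℚ → Expr W → Expr W
    _⊛_      : Expr W → Expr W → Expr W
    call     : ∀ {n k} → Circuit (Fin n) (suc k) → (Fin n → Expr W) → Expr W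

  module _ {W : Set} where

    ⟦_⟧ : Expr W → (W → ℚ) → ℚ
    ⟦ input w ⟧     a = a w
    ⟦ constant q ⟧  a = q
    ⟦ lin u e v f ⟧ a = u ℚ.* ⟦ e ⟧ a ℚ.+ v ℚ.* ⟦ f ⟧ a
    ⟦ e ⊛ f ⟧       a = ⟦ e ⟧ a ℚ.* ⟦ f ⟧ a
    ⟦ call C args ⟧ a = output C (λ i → ⟦ args i ⟧ a)

    cost : Expr W → ℕ
    cost (input w)     = 1
    cost (constant q)  = 1
    cost (lin u e v f) = 3 + (cost e + cost f)
    cost (e ⊛ f)       = 3 + (cost e + cost f)
    cost (call C args) = foldr _+_ 0 (λ i → cost (args i)) + 2 * size C

    totalCost : ∀ {l} → (Fin l → Expr W) → ℕ
    totalCost args = foldr _+_ 0 (λ i → cost (args i))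

    record Compiled {m} (D : Circuit W m) (e : Expr W) : Set where
      field
        m′       : ℕ
        circuit  : Circuit W (suc m′)
        extends  : D ⊑ circuit
        computes : ∀ a → output circuit a ≡ ⟦ e ⟧ a
        size-≤   : size circuit ≤ cost e + size D

    Compiler : Expr W → Set
    Compiler e = ∀ {m} (D : Circuit W m) → Compiled D e

    record CompiledArgs {m l} (D : Circuit W m) (args : Fin l → Expr W) : Set where
      field
        m′         : ℕ
        circuit    : Circuit W m′
        extends    : D ⊑ circuit
        root       : Fin l → Fin m′
        root-value : ∀ a i → value circuit a (root i) ≡ ⟦ args i ⟧ a
        size-≤     : size circuit ≤ totalCost args + size D

    compileArgs : ∀ {l} (args : Fin l → Expr W) → (∀ i → Compiler (args i)) →
                  ∀ {m} (D : Circuit W m) → CompiledArgs D args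
    compileArgs {zero}  args compiler D = record
      { circuit = D ; extends = ⊑-refl ; root = λ () ; root-value = λ _ () ; size-≤ = ℕ.≤-refl }
    compileArgs {suc l} args compiler D = record
      { circuit    = R.circuit
      ; extends    = ⊑-trans H.extends R.extends
      ; root       = root
      ; root-value = root-value
      ; size-≤     = begin
          size R.circuit                           ≤⟨ R.size-≤ ⟩
          T + size H.circuit                       ≤⟨ ℕ.+-monoʳ-≤ T H.size-≤ ⟩
          T + (cost (args zero) + size D)          ≡⟨ regroup T (cost (args zero)) (size D) ⟩
          cost (args zero) + T + size D            ∎
      }
      where
      open ℕ.≤-Reasoning
      module H = Compiled (compiler zero D)
      module R = CompiledArgs (compileArgs (args ∘ suc) (compiler ∘ suc) H.circuit)
      T = totalCost (args ∘ suc)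
      root : Fin (suc l) → Fin R.m′
      root zero    = _⊑_.embed R.extends (fromℕ H.m′)
      root (suc i) = R.root i
      root-value : ∀ a i → value R.circuit a (root i) ≡ ⟦ args i ⟧ a
      root-value a zero    = trans (_⊑_.embed-value R.extends a (fromℕ H.m′))
                                   (trans (sym (output≡value-fromℕ H.circuit a)) (H.computes a))
      root-value a (suc i) = R.root-value a i
      regroup : ∀ t c d → t + (c + d) ≡ c + t + d
      regroup = solve-∀

    withGate : ∀ {m l} {D : Circuit W m} {args : Fin l → Expr W} (R : CompiledArgs D args) (e : Expr W)
               (g : Gate W (CompiledArgs.m′ R)) →
               (∀ a → evalGate g (evalAll (CompiledArgs.circuit R) a) a ≡ ⟦ e ⟧ a) →
               suc (fanin g) + totalCost args ≡ cost e → Compiled D e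
    withGate {D = D} {args} R e g computes cost≡ = record
      { circuit  = R.circuit ▷ g
      ; extends  = ⊑-trans R.extends ⊑-▷
      ; computes = computes
      ; size-≤   = begin
          suc (fanin g + size R.circuit)             ≤⟨ s≤s (ℕ.+-monoʳ-≤ (fanin g) R.size-≤) ⟩
          suc (fanin g + (totalCost args + size D))  ≡⟨ cong suc (ℕ.+-assoc (fanin g) (totalCost args) (size D)) ⟨
          suc (fanin g) + totalCost args + size D    ≡⟨ cong (_+ size D) cost≡ ⟩
          cost e + size D                            ∎
      }
      where
      open ℕ.≤-Reasoning
      module R = CompiledArgs R

    noArgs : ∀ {m} (D : Circuit W m) → CompiledArgs {l = 0} D (λ ())
    noArgs D = compileArgs (λ ()) (λ ()) D

    pair : Expr W → Expr W → Fin 2 → Expr W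
    pair e f zero    = e
    pair e f (suc _) = f

    pairCompiler : ∀ {e f} → Compiler e → Compiler f → ∀ i → Compiler (pair e f i)
    pairCompiler compile-e compile-f zero    = compile-e
    pairCompiler compile-e compile-f (suc _) = compile-f

    compile : (e : Expr W) → Compiler e
    compile (input w)    D = withGate (noArgs D) (input w) (var w) (λ _ → refl) refl
    compile (constant q) D = withGate (noArgs D) (constant q) (const q) (λ _ → refl) refl
    compile (lin u e v f) D =
      withGate compiled (lin u e v f) (add ((u , R.root zero) ∷ (v , R.root (suc zero)) ∷ [])) computes
        (cong (λ t → 3 + (cost e + t)) (ℕ.+-identityʳ (cost f)))
      where
      compiled = compileArgs (pair e f) (pairCompiler (compile e) (compile f)) D
      module R = CompiledArgs compiled
      computes : ∀ a → u ℚ.* value R.circuit a (R.root zero) ℚ.+ (v ℚ.* value R.circuit a (R.root (suc zero)) ℚ.+ 0ℚ)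
                       ≡ u ℚ.* ⟦ e ⟧ a ℚ.+ v ℚ.* ⟦ f ⟧ a
      computes a = cong₂ (λ x y → u ℚ.* x ℚ.+ y) (R.root-value a zero)
                         (trans (+-identityʳ _) (cong (v ℚ.*_) (R.root-value a (suc zero))))
    compile (e ⊛ f) D =
      withGate compiled (e ⊛ f) (mul (R.root zero ∷ R.root (suc zero) ∷ [])) computes
        (cong (λ t → 3 + (cost e + t)) (ℕ.+-identityʳ (cost f)))
      where
      compiled = compileArgs (pair e f) (pairCompiler (compile e) (compile f)) D
      module R = CompiledArgs compiled
      computes : ∀ a → value R.circuit a (R.root zero) ℚ.* (value R.circuit a (R.root (suc zero)) ℚ.* 1ℚ)
                       ≡ ⟦ e ⟧ a ℚ.* ⟦ f ⟧ a
      computes a = cong₂ ℚ._*_ (R.root-value a zero) (trans (*-identityʳ _) (R.root-value a (suc zero)))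
    compile (call (C ▷ g) args) D = record
      { circuit  = Q.circuit ▷ Q.translateGate g
      ; extends  = ⊑-trans R.extends (⊑-trans Q.extends ⊑-▷)
      ; computes = λ a → Q.evalGate-translateGate g a (λ i → ⟦ args i ⟧ a) (R.root-value a)
      ; size-≤   = begin
          size (Q.circuit ▷ Q.translateGate g)          ≤⟨ Q.size-▷-translateGate g ⟩
          2 * size (C ▷ g) + size R.circuit             ≤⟨ ℕ.+-monoʳ-≤ (2 * size (C ▷ g)) R.size-≤ ⟩
          2 * size (C ▷ g) + (totalCost args + size D)  ≡⟨ regroup (2 * size (C ▷ g)) (totalCost args) (size D) ⟩
          totalCost args + 2 * size (C ▷ g) + size D    ∎
      }
      where
      open ℕ.≤-Reasoning
      module R = CompiledArgs (compileArgs args (λ i → compile (args i)) D)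
      module Q = Copy (copy C R.circuit R.root)
      regroup : ∀ s t d → s + (t + d) ≡ t + s + d
      regroup = solve-∀

module Construction (n : ℕ) {k} (C : Circuit (Fin n) (suc k)) where
  open import Data.Nat as ℕ using (ℕ; zero; suc)
  import Data.Nat.Properties as ℕ
  open import Data.Fin using (Fin; zero; suc; toℕ)
  open import Data.Fin.Properties using (toℕ-injective)
  open import Data.Bool using (Bool; true; false; if_then_else_)
  open import Data.Vec using (Vec; lookup)
  open import Data.Product using (_×_; _,_)
  open import Data.Rational using (ℚ; 0ℚ; 1ℚ; _+_; _*_; -_; _-_)
  open import Data.Rational.Properties using (*-identityˡ)
  open import Function using (_∘_)
  open import Relation.Binary.PropositionalEquality
  open import Tactic.RingSolver using (solve-∀)
  open Rationals
  open SubsetSums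
  open Polynomials
  open Interpolation
  open TrinomialProducts
  open Expressions

  W : Set
  W = Fin n × Bool

  geometricExpr : ℚ → Fin n → ℕ → Expr W
  geometricExpr λ′ i zero    = constant 0ℚ
  geometricExpr λ′ i (suc t) = lin 1ℚ (constant 1ℚ) (- λ′) (input (i , false) ⊛ geometricExpr λ′ i t)

  -- λ x_i / (1 + λ x̄_i), with the division replaced by the first n terms of the geometric series.
  substitutionExpr : ℚ → Fin n → Expr W
  substitutionExpr λ′ i = constant λ′ ⊛ (input (i , true) ⊛ geometricExpr λ′ i n)

  prefactorExpr : ℚ → Fin n → Expr W
  prefactorExpr λ′ i = lin 1ℚ (constant 1ℚ) λ′ (input (i , false))

  productExpr : ∀ m → (Fin m → Expr W) → Expr W
  productExpr zero    f = constant 1ℚ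
  productExpr (suc m) f = f zero ⊛ productExpr m (f ∘ suc)

  termExpr : ℚ → Expr W
  termExpr λ′ = productExpr n (prefactorExpr λ′) ⊛ call C (substitutionExpr λ′)

  weightedSumExpr : ∀ m → (Fin m → ℚ) → (Fin m → Expr W) → Expr W
  weightedSumExpr zero    w f = constant 0ℚ
  weightedSumExpr (suc m) w f = lin (w zero) (f zero) 1ℚ (weightedSumExpr m (w ∘ suc) (f ∘ suc))

  degree : ℕ
  degree = n ℕ.* suc n

  point : Fin (suc degree) → ℚ
  point = fromℕ ∘ toℕ

  open Lagrange point (toℕ-injective ∘ fromℕ-injective)

  weight : Fin (suc degree) → ℚ
  weight j = coeff (basis j) n

  pmfExpr : Expr W
  pmfExpr = weightedSumExpr (suc degree) weight (termExpr ∘ point)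

  ⟦⟧-geometricExpr : ∀ λ′ i t x → ⟦ geometricExpr λ′ i t ⟧ x ≡ geometric (λ′ * - x (i , false)) t
  ⟦⟧-geometricExpr λ′ i zero    x = refl
  ⟦⟧-geometricExpr λ′ i (suc t) x =
    trans (cong (λ g → 1ℚ * 1ℚ + - λ′ * (x (i , false) * g)) (⟦⟧-geometricExpr λ′ i t x))
          (regroup λ′ (x (i , false)) (geometric (λ′ * - x (i , false)) t))
    where
    regroup : ∀ λ′ y g → 1ℚ * 1ℚ + - λ′ * (y * g) ≡ 1ℚ + λ′ * - y * g
    regroup = solve-∀ ℚ-ring

  ⟦⟧-productExpr : ∀ m f x → ⟦ productExpr m f ⟧ x ≡ prodFin m (λ i → ⟦ f i ⟧ x)
  ⟦⟧-productExpr zero    f x = refl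
  ⟦⟧-productExpr (suc m) f x = cong (⟦ f zero ⟧ x *_) (⟦⟧-productExpr m (f ∘ suc) x)

  ⟦⟧-weightedSumExpr : ∀ m w f x → ⟦ weightedSumExpr m w f ⟧ x ≡ sum (λ j → w j * ⟦ f j ⟧ x)
  ⟦⟧-weightedSumExpr zero    w f x = refl
  ⟦⟧-weightedSumExpr (suc m) w f x =
    cong ((w zero * ⟦ f zero ⟧ x) +_) (trans (*-identityˡ _) (⟦⟧-weightedSumExpr m (w ∘ suc) (f ∘ suc) x))

  constantCoeffs : Vec Bool n → Fin n → ℚ
  constantCoeffs S i = if lookup S i then 0ℚ else 1ℚ

  linearCoeffs : (W → ℚ) → Vec Bool n → Fin n → ℚ
  linearCoeffs x S i = x (i , lookup S i)

  tailCoeffs : (W → ℚ) → Vec Bool n → Fin n → ℚ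
  tailCoeffs x S i = if lookup S i then - x (i , true) * (- x (i , false)) ^ n else 0ℚ

  -- Π_i (1 + λ x̄_i) · Π_{i∈S} z_i(λ), with z_i truncated as in `substitutionExpr`, as a
  -- polynomial in λ.
  liftedMonomial : (W → ℚ) → Vec Bool n → Poly
  liftedMonomial x S = trinomialProduct (suc n) n (constantCoeffs S) (linearCoeffs x S) (tailCoeffs x S)

  factor-identity : ∀ x S λ′ i →
    ⟦ prefactorExpr λ′ i ⟧ x * (if lookup S i then ⟦ substitutionExpr λ′ i ⟧ x else 1ℚ)
      ≡ constantCoeffs S i + λ′ * linearCoeffs x S i + λ′ ^ suc n * tailCoeffs x S i
  factor-identity x S λ′ i with lookup S i
  ... | false = absent λ′ (x (i , false)) (λ′ ^ suc n)
    where
    absent : ∀ λ′ y z → (1ℚ * 1ℚ + λ′ * y) * 1ℚ ≡ 1ℚ + λ′ * y + z * 0ℚ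
    absent = solve-∀ ℚ-ring
  ... | true  = begin
    (1ℚ * 1ℚ + λ′ * y) * (λ′ * (x₁ * ⟦ geometricExpr λ′ i n ⟧ x))
      ≡⟨ cong (λ g → (1ℚ * 1ℚ + λ′ * y) * (λ′ * (x₁ * g))) (⟦⟧-geometricExpr λ′ i n x) ⟩
    (1ℚ * 1ℚ + λ′ * y) * (λ′ * (x₁ * geometric q n))  ≡⟨ regroup λ′ y x₁ (geometric q n) ⟩
    λ′ * x₁ * ((1ℚ - q) * geometric q n)              ≡⟨ cong (λ′ * x₁ *_) (geometric-closed q n) ⟩
    λ′ * x₁ * (1ℚ - q ^ n)                            ≡⟨ cong (λ r → λ′ * x₁ * (1ℚ - r)) (^-distrib-* λ′ (- y) n) ⟩
    λ′ * x₁ * (1ℚ - λ′ ^ n * (- y) ^ n)               ≡⟨ expand λ′ x₁ (λ′ ^ n) ((- y) ^ n) ⟩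
    0ℚ + λ′ * x₁ + λ′ * λ′ ^ n * (- x₁ * (- y) ^ n)   ∎
    where
    open ≡-Reasoning
    x₁ = x (i , true)
    y  = x (i , false)
    q  = λ′ * - y
    regroup : ∀ λ′ y x₁ g → (1ℚ * 1ℚ + λ′ * y) * (λ′ * (x₁ * g)) ≡ λ′ * x₁ * ((1ℚ - λ′ * - y) * g)
    regroup = solve-∀ ℚ-ring
    expand : ∀ λ′ x₁ l r → λ′ * x₁ * (1ℚ - l * r) ≡ 0ℚ + λ′ * x₁ + λ′ * l * (- x₁ * r)
    expand = solve-∀ ℚ-ring

  module _ (p : Vec Bool n → ℚ) (C-computes : ∀ z → output C z ≡ genPoly n p z) where

    ⟦⟧-termExpr : ∀ λ′ x → ⟦ termExpr λ′ ⟧ x ≡ sumSubsets n (λ S → p S * eval (liftedMonomial x S) λ′)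
    ⟦⟧-termExpr λ′ x = begin
      A * output C z                        ≡⟨ cong (A *_) (C-computes z) ⟩
      A * sumSubsets n (λ S → p S * Z S)    ≡⟨ *-distribˡ-sumSubsets n A (λ S → p S * Z S) ⟩
      sumSubsets n (λ S → A * (p S * Z S))
        ≡⟨ sumSubsets-cong n (λ S → trans (swap A (p S) (Z S)) (cong (p S *_) (lifted S))) ⟩
      sumSubsets n (λ S → p S * eval (liftedMonomial x S) λ′) ∎
      where
      open ≡-Reasoning
      A = ⟦ productExpr n (prefactorExpr λ′) ⟧ x
      z = λ i → ⟦ substitutionExpr λ′ i ⟧ x
      Z : Vec Bool n → ℚ
      Z S = prodFin n (λ i → if lookup S i then z i else 1ℚ)
      swap : ∀ a b c → a * (b * c) ≡ b * (a * c)
      swap = solve-∀ ℚ-ring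
      lifted : ∀ S → A * Z S ≡ eval (liftedMonomial x S) λ′
      lifted S = begin
        A * Z S                                           ≡⟨ cong (_* Z S) (⟦⟧-productExpr n (prefactorExpr λ′) x) ⟩
        prodFin n (λ i → ⟦ prefactorExpr λ′ i ⟧ x) * Z S  ≡⟨ prodFin-* n _ _ ⟩
        prodFin n (λ i → ⟦ prefactorExpr λ′ i ⟧ x * (if lookup S i then z i else 1ℚ))
          ≡⟨ prodFin-cong n (factor-identity x S λ′) ⟩
        prodFin n (λ i → constantCoeffs S i + λ′ * linearCoeffs x S i + λ′ ^ suc n * tailCoeffs x S i)
          ≡⟨ eval-trinomialProduct (suc n) n (constantCoeffs S) (linearCoeffs x S) (tailCoeffs x S) λ′ ⟨
        eval (liftedMonomial x S) λ′                      ∎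

    ⟦⟧-pmfExpr : ∀ x → ⟦ pmfExpr ⟧ x ≡ pmfPoly n p x
    ⟦⟧-pmfExpr x = begin
      ⟦ pmfExpr ⟧ x
        ≡⟨ ⟦⟧-weightedSumExpr (suc degree) weight (termExpr ∘ point) x ⟩
      sum (λ j → weight j * ⟦ termExpr (point j) ⟧ x)
        ≡⟨ sum-cong-≗ (λ j → cong (weight j *_) (⟦⟧-termExpr (point j) x)) ⟩
      sum (λ j → weight j * sumSubsets n (λ S → p S * E S j))
        ≡⟨ sum-cong-≗ (λ j → *-distribˡ-sumSubsets n (weight j) (λ S → p S * E S j)) ⟩
      sum (λ j → sumSubsets n (λ S → weight j * (p S * E S j)))
        ≡⟨ sum-sumSubsets n (λ j S → weight j * (p S * E S j)) ⟩
      sumSubsets n (λ S → sum (λ j → weight j * (p S * E S j)))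
        ≡⟨ sumSubsets-cong n (λ S → sum-cong-≗ (λ j → swap (weight j) (p S) (E S j))) ⟩
      sumSubsets n (λ S → sum (λ j → p S * (E S j * weight j)))
        ≡⟨ sumSubsets-cong n (λ S → *-distribˡ-sum (p S) (λ j → E S j * weight j)) ⟨
      sumSubsets n (λ S → p S * sum (λ j → E S j * weight j))
        ≡⟨ sumSubsets-cong n (λ S → cong (p S *_) (coefficient S)) ⟨
      pmfPoly n p x  ∎
      where
      open ≡-Reasoning
      E : Vec Bool n → Fin (suc degree) → ℚ
      E S j = eval (liftedMonomial x S) (point j)
      swap : ∀ w a e → w * (a * e) ≡ a * (e * w)
      swap = solve-∀ ℚ-ring
      coefficient : ∀ S → prodFin n (linearCoeffs x S) ≡ sum (λ j → E S j * weight j)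
      coefficient S = begin
        prodFin n (linearCoeffs x S)
          ≡⟨ coeff-trinomialProduct (suc n) n (constantCoeffs S) (linearCoeffs x S) (tailCoeffs x S) (ℕ.n<1+n n) ⟨
        coeff (liftedMonomial x S) n
          ≡⟨ coeff-lagrange (liftedMonomial x S) (ℕ.≤-reflexive (length-trinomialProduct n n _ _ _)) n ⟩
        sum (λ j → E S j * weight j)  ∎

module Costs (n : ℕ) {k} (C : Circuit (Fin n) (suc k)) where
  open import Data.Nat using (zero; _+_; _*_)
  open import Data.Fin using (zero; suc)
  open import Data.Nat.Tactic.RingSolver using (solve-∀)
  open import Function using (_∘_)
  open import Relation.Binary.PropositionalEquality
  open Expressions
  open Construction n C

  private
    iterate-cost : ∀ m c → 3 + (c + suc (m * (3 + c))) ≡ suc (suc m * (3 + c))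
    iterate-cost = solve-∀

  cost-geometricExpr : ∀ λ′ i t → cost (geometricExpr λ′ i t) ≡ suc (8 * t)
  cost-geometricExpr λ′ i zero    = refl
  cost-geometricExpr λ′ i (suc t) =
    trans (cong (λ c → 3 + (1 + (3 + (1 + c)))) (cost-geometricExpr λ′ i t)) (regroup t)
    where
    regroup : ∀ t → 3 + (1 + (3 + (1 + suc (8 * t)))) ≡ suc (8 * suc t)
    regroup = solve-∀

  cost-substitutionExpr : ∀ λ′ i → cost (substitutionExpr λ′ i) ≡ 9 + 8 * n
  cost-substitutionExpr λ′ i =
    trans (cong (λ c → 3 + (1 + (3 + (1 + c)))) (cost-geometricExpr λ′ i n)) (regroup n)
    where
    regroup : ∀ n → 3 + (1 + (3 + (1 + suc (8 * n)))) ≡ 9 + 8 * n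
    regroup = solve-∀

  totalCost-constant : ∀ m (f : Fin m → Expr W) c → (∀ i → cost (f i) ≡ c) → totalCost f ≡ m * c
  totalCost-constant zero    f c f≡c = refl
  totalCost-constant (suc m) f c f≡c = cong₂ _+_ (f≡c zero) (totalCost-constant m (f ∘ suc) c (f≡c ∘ suc))

  cost-productExpr : ∀ m f c → (∀ i → cost (f i) ≡ c) → cost (productExpr m f) ≡ suc (m * (3 + c))
  cost-productExpr zero    f c f≡c = refl
  cost-productExpr (suc m) f c f≡c =
    trans (cong₂ (λ u v → 3 + (u + v)) (f≡c zero) (cost-productExpr m (f ∘ suc) c (f≡c ∘ suc))) (iterate-cost m c)

  cost-weightedSumExpr : ∀ m w f c → (∀ j → cost (f j) ≡ c) → cost (weightedSumExpr m w f) ≡ suc (m * (3 + c))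
  cost-weightedSumExpr zero    w f c f≡c = refl
  cost-weightedSumExpr (suc m) w f c f≡c =
    trans (cong₂ (λ u v → 3 + (u + v)) (f≡c zero) (cost-weightedSumExpr m (w ∘ suc) (f ∘ suc) c (f≡c ∘ suc)))
          (iterate-cost m c)

  termCost : ℕ
  termCost = 3 + (suc (n * 8) + (n * (9 + 8 * n) + 2 * size C))

  cost-termExpr : ∀ λ′ → cost (termExpr λ′) ≡ termCost
  cost-termExpr λ′ = cong₂ (λ u v → 3 + (u + (v + 2 * size C)))
    (cost-productExpr n (prefactorExpr λ′) 5 (λ _ → refl))
    (totalCost-constant n (substitutionExpr λ′) (9 + 8 * n) (cost-substitutionExpr λ′))

  cost-pmfExpr : cost pmfExpr ≡ suc (suc degree * (3 + termCost))
  cost-pmfExpr = cost-weightedSumExpr (suc degree) weight (termExpr ∘ point) termCost (cost-termExpr ∘ point)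

module SizeBound where
  open import Data.Nat using (ℕ; suc; _+_; _*_; _^_; _≤_; s≤s; >-nonZero)
  import Data.Nat.Properties as ℕ
  open import Data.Nat.Tactic.RingSolver using (solve-∀)
  open import Relation.Binary.PropositionalEquality
  open ℕ.≤-Reasoning

  polynomial-bound : ∀ n s → 1 ≤ s →
    suc (suc (n * suc n) * (3 + (3 + (suc (n * 8) + (n * (9 + 8 * n) + 2 * s))))) ≤ 34 + 34 * (s + n) ^ 34
  polynomial-bound n s 1≤s = begin
    suc (suc (n * suc n) * X)  ≤⟨ s≤s (ℕ.*-mono-≤ points≤Q X≤34Q) ⟩
    suc (Q * (34 * Q))         ≡⟨ cong suc (fourth-power B) ⟩
    suc (34 * B ^ 4)           ≤⟨ ℕ.+-mono-≤ (ℕ.m≤m+n 1 33) (ℕ.*-monoʳ-≤ 34 (ℕ.^-monoʳ-≤ B (ℕ.m≤m+n 4 30))) ⟩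
    34 + 34 * B ^ 34           ∎
    where
    B = s + n
    Q = B * B
    X = 3 + (3 + (suc (n * 8) + (n * (9 + 8 * n) + 2 * s)))
    1≤B : 1 ≤ B
    1≤B = ℕ.≤-trans 1≤s (ℕ.m≤m+n s n)
    instance _ = >-nonZero 1≤B
    B≤Q : B ≤ Q
    B≤Q = ℕ.m≤m*n B B
    points≤Q : suc (n * suc n) ≤ Q
    points≤Q = ℕ.≤-trans (s≤s (ℕ.m≤n+m (n * suc n) n)) (ℕ.*-mono-≤ 1+n≤B 1+n≤B)
      where 1+n≤B = ℕ.+-monoˡ-≤ n 1≤s
    X≤34Q : X ≤ 34 * Q
    X≤34Q = begin
      X                                     ≡⟨ expand n s ⟩
      7 * 1 + 17 * n + 8 * (n * n) + 2 * s  ≤⟨ ℕ.+-mono-≤ (ℕ.+-mono-≤ (ℕ.+-mono-≤ (ℕ.*-monoʳ-≤ 7 (ℕ.≤-trans 1≤B B≤Q))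
                                                                     (ℕ.*-monoʳ-≤ 17 (ℕ.≤-trans (ℕ.m≤n+m n s) B≤Q)))
                                                        (ℕ.*-monoʳ-≤ 8 (ℕ.*-mono-≤ (ℕ.m≤n+m n s) (ℕ.m≤n+m n s))))
                                           (ℕ.*-monoʳ-≤ 2 (ℕ.≤-trans (ℕ.m≤m+n s n) B≤Q)) ⟩
      7 * Q + 17 * Q + 8 * Q + 2 * Q        ≡⟨ collect Q ⟩
      34 * Q                                ∎
      where
      expand : ∀ n s → 3 + (3 + (suc (n * 8) + (n * (9 + 8 * n) + 2 * s))) ≡ 7 * 1 + 17 * n + 8 * (n * n) + 2 * s
      expand = solve-∀
      collect : ∀ q → 7 * q + 17 * q + 8 * q + 2 * q ≡ 34 * q
      collect = solve-∀
    fourth-power : ∀ b → b * b * (34 * (b * b)) ≡ 34 * (b * (b * (b * (b * 1))))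
    fourth-power = solve-∀

open import Data.Nat using (ℕ; suc; _+_; _*_; _^_; _≤_)
open import Data.Fin using (Fin)
open import Data.Bool using (Bool)
open import Data.Vec using (Vec)
open import Data.Nat.Properties using (+-identityʳ; module ≤-Reasoning)
open import Data.Product using (_×_; Σ; ∃-syntax; _,_)
open import Data.Rational using (ℚ; 0ℚ; 1ℚ)
import Data.Rational as Q
open import Relation.Binary.PropositionalEquality using (_≡_; trans)

pmfCircuit : ∀ n (p : Vec Bool n → ℚ) {k} (C : Circuit (Fin n) (suc k)) → (∀ z → output C z ≡ genPoly n p z) →
             ∃[ k′ ] Σ (Circuit (Fin n × Bool) (suc k′)) (λ D →
               (size D ≤ 34 + 34 * (size C + n) ^ 34) × (∀ x → output D x ≡ pmfPoly n p x))
pmfCircuit n p C C-computes = D.m′ , D.circuit , size-bound , λ x → trans (D.computes x) (⟦⟧-pmfExpr p C-computes x)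
  where
  open Construction n C
  open Costs n C using (termCost; cost-pmfExpr)
  open Expressions using (cost; compile)
  open ≤-Reasoning
  module D = Expressions.Compiled (compile pmfExpr [])
  size-bound : size D.circuit ≤ 34 + 34 * (size C + n) ^ 34
  size-bound = begin
    size D.circuit                               ≤⟨ D.size-≤ ⟩
    cost pmfExpr + 0                             ≡⟨ trans (+-identityʳ (cost pmfExpr)) cost-pmfExpr ⟩
    suc (suc degree * (3 + termCost))            ≤⟨ SizeBound.polynomial-bound n (size C) (Circuits.size-positive C) ⟩
    34 + 34 * (size C + n) ^ 34                  ∎

theorem4 : ∃[ c ] ((n : ℕ) (p : Vec Bool n → ℚ) →
             (∀ S → 0ℚ Q.≤ p S) → sumSubsets n p ≡ 1ℚ →
             ∀ {k} (C : Circuit (Fin n) (suc k)) →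
             (∀ z → output C z ≡ genPoly n p z) →
             ∃[ k′ ] Σ (Circuit (Fin n × Bool) (suc k′)) (λ D →
               (size D ≤ c + c * (size C + n) ^ c) ×
               (∀ x → output D x ≡ pmfPoly n p x)))
theorem4 = 34 , λ n p _ _ C C-computes → pmfCircuit n p C C-computes
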